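{- Let $r>k\ge1$, let $A\subseteq\mathbb{Z}/r\mathbb{Z}$ be nonempty and $k$-symmetric, and let $R=\{(w,w+a)\mid w\in\mathbb{Z}/r\mathbb{Z},a\in A\}$. Then for all $w\in\mathbb{Z}/r\mathbb{Z}$, all modal formulas $\Phi$ and all valuations $V\subseteq\mathbb{Z}/r\mathbb{Z}$, with $M=(\mathbb{Z}/r\mathbb{Z},R,V)$: $M\vDash w+k:\Phi$ implies $M\vDash w:\Box\Diamond\Phi$, and $M\vDash w:\Diamond\Box\Phi$ implies $M\vDash w+k:\Phi$.
   Context: $A$ is $k$-symmetric if $k-a\in A$ for all $a\in A$. Formulas are built from one variable $p$ with $\Box,\Diamond,\lnot$. Kripke semantics: $M\vDash w:p$ iff $w\in V$; $M\vDash w:\Box\Phi$ iff $M\vDash w':\Phi$ for all $w'$ with $(w,w')\in R$; $M\vDash w:\Diamond\Phi$ iff $M\vDash w':\Phi$ for some $w'$ with $(w,w')\in R$; $\lnot$ is classical negation. -}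

module Defs where

open import Data.Nat using (ℕ; zero; suc; _+_; _∸_; _<_; _≤_; NonZero)
open import Data.Nat.DivMod using (_mod_)
open import Data.Fin using (Fin; toℕ)
open import Data.Product using (Σ; _×_; ∃)
open import Data.Empty using (⊥)
open import Relation.Nullary using (¬_)

-- Z/rZ is represented by Fin r, with arithmetic modulo r.
module _ {r : ℕ} .{{_ : NonZero r}} where

  [_]ᵣ : ℕ → Fin r
  [ n ]ᵣ = n mod r

  _+ᵣ_ : Fin r → Fin r → Fin r
  a +ᵣ b = (toℕ a + toℕ b) mod r

  _-ᵣ_ : Fin r → Fin r → Fin r
  a -ᵣ b = (toℕ a + (r ∸ toℕ b)) mod r

Subset : ℕ → Set₁
Subset r = Fin r → Set

KSymmetric : (r : ℕ) .{{_ : NonZero r}} → ℕ → Subset r → Set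
KSymmetric r k A = ∀ a → A a → A ([ k ]ᵣ -ᵣ a)

data Formula : Set where
  p   : Formula
  ¬'_ : Formula → Formula
  □_  : Formula → Formula
  ◇_  : Formula → Formula

record Model (W : Set) : Set₁ where
  field
    R : W → W → Set
    V : W → Set

open Model public

_⊨_∶_ : {W : Set} → Model W → W → Formula → Set
M ⊨ w ∶ p      = V M w
M ⊨ w ∶ (¬' Φ) = ¬ (M ⊨ w ∶ Φ)
M ⊨ w ∶ (□ Φ)  = ∀ w' → R M w w' → M ⊨ w' ∶ Φ
M ⊨ w ∶ (◇ Φ)  = ∃ λ w' → R M w w' × M ⊨ w' ∶ Φ

RelA : (r : ℕ) .{{_ : NonZero r}} → Subset r → Fin r → Fin r → Set
RelA r A w w' = Σ (Fin r) λ a → A a × (w' ≡ w +ᵣ a)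
  where open import Relation.Binary.PropositionalEquality using (_≡_)

ModelA : (r : ℕ) .{{_ : NonZero r}} → Subset r → Subset r → Model (Fin r)
ModelA r A V' = record { R = RelA r A ; V = V' }

-- Since A is k-symmetric, from any successor w + a of w the step by k − a ∈ A lands on
-- w + k. So w + k is a successor of every successor of w, which gives both
-- M ⊨ w + k : Φ ⇒ M ⊨ w : □◇Φ and M ⊨ w : ◇□Φ ⇒ M ⊨ w + k : Φ in any Kripke model.
module Submission where

open import Defs
open import Data.Nat using (ℕ; _<_; _≤_; NonZero; _+_; _∸_; _%_)
open import Data.Nat.Properties using (m+[n∸m]≡n; <⇒≤)
open import Data.Nat.DivMod using (_mod_; %-distribˡ-+; [m+n]%n≡m%n)
open import Data.Nat.Tactic.RingSolver using (solve-∀)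
open import Data.Fin using (Fin; toℕ)
open import Data.Fin.Properties using (toℕ-fromℕ<; toℕ-injective; toℕ<n)
open import Data.Product using (∃; _×_; _,_)
open import Relation.Binary.PropositionalEquality

+-∸-rearrange : ∀ {a r} → a ≤ r → ∀ w b → w + a + (b + (r ∸ a)) ≡ (w + b) + r
+-∸-rearrange {a} {r} a≤r w b = begin
  w + a + (b + (r ∸ a))   ≡⟨ shuffle w a b (r ∸ a) ⟩
  w + b + (a + (r ∸ a))   ≡⟨ cong (w + b +_) (m+[n∸m]≡n a≤r) ⟩
  w + b + r               ∎
  where
  open ≡-Reasoning
  shuffle : ∀ w a b s → w + a + (b + s) ≡ w + b + (a + s)
  shuffle = solve-∀

module _ {r : ℕ} .{{_ : NonZero r}} where

  toℕ-+ᵣ : ∀ (x y : Fin r) → toℕ (x +ᵣ y) ≡ (toℕ x + toℕ y) % r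
  toℕ-+ᵣ x y = toℕ-fromℕ< _

  toℕ--ᵣ : ∀ (x y : Fin r) → toℕ (x -ᵣ y) ≡ (toℕ x + (r ∸ toℕ y)) % r
  toℕ--ᵣ x y = toℕ-fromℕ< _

  +ᵣ-cancel--ᵣ : ∀ (w a b : Fin r) → (w +ᵣ a) +ᵣ (b -ᵣ a) ≡ w +ᵣ b
  +ᵣ-cancel--ᵣ w a b = toℕ-injective (begin
    toℕ ((w +ᵣ a) +ᵣ (b -ᵣ a))                   ≡⟨ toℕ-+ᵣ (w +ᵣ a) (b -ᵣ a) ⟩
    (toℕ (w +ᵣ a) + toℕ (b -ᵣ a)) % r            ≡⟨ cong₂ (λ x y → (x + y) % r) (toℕ-+ᵣ w a) (toℕ--ᵣ b a) ⟩
    ((W + A) % r + (B + (r ∸ A)) % r) % r        ≡⟨ %-distribˡ-+ (W + A) (B + (r ∸ A)) r ⟨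
    (W + A + (B + (r ∸ A))) % r                  ≡⟨ cong (_% r) (+-∸-rearrange (<⇒≤ (toℕ<n a)) W B) ⟩
    (W + B + r) % r                              ≡⟨ [m+n]%n≡m%n (W + B) r ⟩
    (W + B) % r                                  ≡⟨ toℕ-+ᵣ w b ⟨
    toℕ (w +ᵣ b)                                 ∎)
    where
    open ≡-Reasoning
    W = toℕ w
    A = toℕ a
    B = toℕ b

  RelA-successor-sees-+ᵣ : ∀ (A : Subset r) b → (∀ a → A a → A (b -ᵣ a)) →
    ∀ {w w'} → RelA r A w w' → RelA r A w' (w +ᵣ b)
  RelA-successor-sees-+ᵣ A b closed {w} (a , a∈A , refl) =
    b -ᵣ a , closed a a∈A , sym (+ᵣ-cancel--ᵣ w a b)

module _ {W : Set} (M : Model W) {w v : W} (sees-v : ∀ {w'} → R M w w' → R M w' v) where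

  ⊨⇒⊨□◇ : ∀ Φ → M ⊨ v ∶ Φ → M ⊨ w ∶ (□ (◇ Φ))
  ⊨⇒⊨□◇ Φ v⊨Φ w' wRw' = v , sees-v wRw' , v⊨Φ

  ⊨◇□⇒⊨ : ∀ Φ → M ⊨ w ∶ (◇ (□ Φ)) → M ⊨ v ∶ Φ
  ⊨◇□⇒⊨ Φ (w' , wRw' , w'⊨□Φ) = w'⊨□Φ v (sees-v wRw')

lemma7 : (r k : ℕ) .{{_ : NonZero r}} → 1 ≤ k → k < r →
    (A : Subset r) → ∃ A → KSymmetric r k A →
    ∀ (w : Fin r) (Φ : Formula) (V : Subset r) →
    (ModelA r A V ⊨ (w +ᵣ [ k ]ᵣ) ∶ Φ → ModelA r A V ⊨ w ∶ (□ (◇ Φ)))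
    × (ModelA r A V ⊨ w ∶ (◇ (□ Φ)) → ModelA r A V ⊨ (w +ᵣ [ k ]ᵣ) ∶ Φ)
lemma7 r k _ _ A _ k-symmetric w Φ V = ⊨⇒⊨□◇ M sees-w+k Φ , ⊨◇□⇒⊨ M sees-w+k Φ
  where
  M = ModelA r A V
  sees-w+k : ∀ {w'} → RelA r A w w' → RelA r A w' (w +ᵣ [ k ]ᵣ)
  sees-w+k = RelA-successor-sees-+ᵣ A [ k ]ᵣ k-symmetric
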